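{- Let $G=(Q,A,T)$ be a structurally-reversible $I$-unfolding of a Petri net $A$. For every cycle $\theta$ of $G$ there exists a cycle $\theta'$ of $G$ such that $\Delta(\theta')=-\Delta(\theta)$.
   Context: Fix $d\ge1$. A Petri net action is a pair $a=(\mathbf{a}_-,\mathbf{a}_+)$ of vectors of $\mathbb{N}^d$ with displacement $\Delta(a)=\mathbf{a}_+-\mathbf{a}_-$; a Petri net is a finite set $A$ of actions. For $I\subseteq\{1,\ldots,d\}$ and $p,q\in\mathbb{N}^I$, $p\xrightarrow{a}q$ iff $p=\mathbf{a}_-|_I+\mathbf{c}$, $q=\mathbf{a}_+|_I+\mathbf{c}$ for some $\mathbf{c}\in\mathbb{N}^I$. An $I$-unfolding of $A$ is a strongly-connected directed graph $G=(Q,A,T)$ with $Q$ a nonempty finite subset of $\mathbb{N}^I$, $T\subseteq Q\times A\times Q$ and $p\xrightarrow{a}q$ for all $(p,a,q)\in T$. A path is a word of consecutive transitions, a cycle is a path ending where it starts, and the displacement $\Delta(\pi)$ of a path is the sum of the displacements of the actions labelling its transitions. $G$ is structurally-reversible if for every transition $t=(p,a,q)\in T$ there is a path $\pi$ from $q$ to $p$ with $\Delta(t\pi)=\Delta(a)+\Delta(\pi)=\mathbf{0}$. -}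

module Defs where

open import Data.Nat using (ℕ; _+_)
open import Data.Integer as ℤ using (ℤ)
open import Data.Fin using (Fin)
open import Data.Vec using (Vec; lookup)
open import Data.Fin.Subset using (Subset; _∈_; _∉_)
open import Data.List using (List; []; _∷_)
open import Data.List.Relation.Unary.All using (All)
open import Data.List.Membership.Propositional using () renaming (_∈_ to _∈ₗ_)
open import Data.Product using (Σ; ∃; _×_; _,_; proj₁; proj₂)
open import Relation.Binary.PropositionalEquality using (_≡_)

record Action (d : ℕ) : Set where
  constructor act
  field
    minus : Vec ℕ d
    plus  : Vec ℕ d
open Action public

PetriNet : ℕ → Set
PetriNet d = List (Action d)

Disp : ℕ → Set
Disp d = Fin d → ℤ

Δ : ∀ {d} → Action d → Disp d
Δ a i = ℤ.+ (lookup (plus a) i) ℤ.- ℤ.+ (lookup (minus a) i)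

𝟎 : ∀ {d} → Disp d
𝟎 _ = ℤ.0ℤ

_⊕_ : ∀ {d} → Disp d → Disp d → Disp d
(u ⊕ v) i = u i ℤ.+ v i

⊖_ : ∀ {d} → Disp d → Disp d
(⊖ u) i = ℤ.- u i

_≐_ : ∀ {d} → Disp d → Disp d → Set
u ≐ v = ∀ i → u i ≡ v i

-- Elements of ℕ^I are encoded as vectors of ℕ^d whose coordinates
-- outside I are 0 (a canonical representative).
InNI : ∀ {d} → Subset d → Vec ℕ d → Set
InNI {d} I p = ∀ (i : Fin d) → i ∉ I → lookup p i ≡ 0

Step : ∀ {d} → Subset d → Vec ℕ d → Action d → Vec ℕ d → Set
Step {d} I p a q =
  Σ (Vec ℕ d) λ c → InNI I c ×
    (∀ (i : Fin d) → i ∈ I →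
       (lookup p i ≡ lookup (minus a) i + lookup c i) ×
       (lookup q i ≡ lookup (plus a) i + lookup c i))

record Transition (d : ℕ) : Set where
  constructor tr
  field
    src : Vec ℕ d
    lab : Action d
    tgt : Vec ℕ d
open Transition public

record Graph (d : ℕ) : Set where
  constructor graph
  field
    states : List (Vec ℕ d)
    trans  : List (Transition d)
open Graph public

data Path {d} (G : Graph d) : Vec ℕ d → Vec ℕ d → Set where
  []  : ∀ {p} → Path G p p
  _∷_ : ∀ {r} (t : Transition d) → t ∈ₗ trans G → Path G (tgt t) r →
        Path G (src t) r

ΔP : ∀ {d} {G : Graph d} {p q} → Path G p q → Disp d
ΔP []          = 𝟎
ΔP (_∷_ t _ π) = Δ (lab t) ⊕ ΔP π

Cycle : ∀ {d} → Graph d → Set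
Cycle G = Σ _ λ p → Path G p p

ΔC : ∀ {d} {G : Graph d} → Cycle G → Disp d
ΔC (_ , θ) = ΔP θ

record IsUnfolding {d} (I : Subset d) (A : PetriNet d) (G : Graph d) : Set where
  field
    nonempty        : Σ _ λ p → p ∈ₗ states G
    states-in-NI    : All (InNI I) (states G)
    trans-src       : ∀ {t} → t ∈ₗ trans G → src t ∈ₗ states G
    trans-tgt       : ∀ {t} → t ∈ₗ trans G → tgt t ∈ₗ states G
    trans-action    : ∀ {t} → t ∈ₗ trans G → lab t ∈ₗ A
    trans-step      : ∀ {t} → t ∈ₗ trans G → Step I (src t) (lab t) (tgt t)
    strongly-conn   : ∀ {p q} → p ∈ₗ states G → q ∈ₗ states G → Path G p q

StructurallyReversible : ∀ {d} → Graph d → Set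
StructurallyReversible {d} G =
  ∀ (t : Transition d) → t ∈ₗ trans G →
    Σ (Path G (tgt t) (src t)) λ π → (Δ (lab t) ⊕ ΔP π) ≐ 𝟎

{-# OPTIONS --safe #-}
module Submission where

-- A path t π from p to q is undone by first undoing π and then following the
-- return path of t given by structural reversibility; by induction every path
-- has a return path of opposite displacement, and for a cycle this return path
-- is again a cycle.

open import Defs
open import Algebra.Bundles using (AbelianGroup)
open import Data.Nat using (ℕ)
open import Data.Fin.Subset using (Subset)
open import Data.Product using (Σ; _,_)
open import Data.Integer as ℤ using (ℤ)
import Data.Integer.Properties as ℤ
open import Relation.Binary.PropositionalEquality using (refl; cong; cong₂; sym)
open Relation.Binary.PropositionalEquality.≡-Reasoning
open import Algebra.Properties.Group (AbelianGroup.group ℤ.+-0-abelianGroup)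
  using (inverseʳ-unique)

_++ₚ_ : ∀ {d} {G : Graph d} {p q r} → Path G p q → Path G q r → Path G p r
[] ++ₚ ρ = ρ
(_∷_ t t∈T π) ++ₚ ρ = _∷_ t t∈T (π ++ₚ ρ)

ΔP-++ : ∀ {d} {G : Graph d} {p q r} (π : Path G p q) (ρ : Path G q r) →
  ΔP (π ++ₚ ρ) ≐ (ΔP π ⊕ ΔP ρ)
ΔP-++ [] ρ i = sym (ℤ.+-identityˡ _)
ΔP-++ (_∷_ t _ π) ρ i = begin
  Δ (lab t) i ℤ.+ ΔP (π ++ₚ ρ) i            ≡⟨ cong (ℤ._+_ (Δ (lab t) i)) (ΔP-++ π ρ i) ⟩
  Δ (lab t) i ℤ.+ (ΔP π i ℤ.+ ΔP ρ i)       ≡⟨ ℤ.+-assoc (Δ (lab t) i) _ _ ⟨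
  (Δ (lab t) i ℤ.+ ΔP π i) ℤ.+ ΔP ρ i       ∎

⊕≐𝟎⇒≐⊖ : ∀ {d} {u v : Disp d} → (u ⊕ v) ≐ 𝟎 → v ≐ (⊖ u)
⊕≐𝟎⇒≐⊖ {u = u} {v} u⊕v≐𝟎 i = inverseʳ-unique (u i) (v i) (u⊕v≐𝟎 i)

reversePath : ∀ {d} {G : Graph d} → StructurallyReversible G →
  ∀ {p q} (π : Path G p q) → Σ (Path G q p) λ ρ → ΔP ρ ≐ (⊖ ΔP π)
reversePath rev [] = [] , λ _ → refl
reversePath rev (_∷_ t t∈T π) with reversePath rev π | rev t t∈T
... | ρ , Δρ≐⊖Δπ | σ , Δt⊕Δσ≐𝟎 = ρ ++ₚ σ , λ i → begin
  ΔP (ρ ++ₚ σ) i                         ≡⟨ ΔP-++ ρ σ i ⟩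
  ΔP ρ i ℤ.+ ΔP σ i                      ≡⟨ cong₂ ℤ._+_ (Δρ≐⊖Δπ i) (⊕≐𝟎⇒≐⊖ {u = Δ (lab t)} Δt⊕Δσ≐𝟎 i) ⟩
  ℤ.- ΔP π i ℤ.+ ℤ.- Δ (lab t) i         ≡⟨ ℤ.+-comm (ℤ.- ΔP π i) _ ⟩
  ℤ.- Δ (lab t) i ℤ.+ ℤ.- ΔP π i         ≡⟨ ℤ.neg-distrib-+ (Δ (lab t) i) (ΔP π i) ⟨
  ℤ.- (Δ (lab t) i ℤ.+ ΔP π i)           ∎

lemma20 : (d : ℕ) (I : Subset d) (A : PetriNet d) (G : Graph d) →
    IsUnfolding I A G → StructurallyReversible G →
    (θ : Cycle G) → Σ (Cycle G) λ θ′ → ΔC θ′ ≐ (⊖ ΔC θ)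
lemma20 d I A G _ rev (p , θ) with reversePath rev θ
... | θ′ , Δθ′≐⊖Δθ = (p , θ′) , Δθ′≐⊖Δθ
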